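{- Let $n \geq 2$ be an integer and let $m = d^+(v_{n-1})$. If $n-1 \neq m + d^+(v_m)$, then $m = d^+(v_n)$, $n = m + d^+(v_m)$, and $\epsilon(J_{n-1}(1)) = \epsilon(J_n(1)) - d^+(v_m)$.
   Context: The infinite Jaco graph $J_\infty(1)$ is the directed graph with vertex set $\{v_i : i \in \mathbb{N}\}$ ($\mathbb{N}=\{1,2,3,\dots\}$) whose arcs are defined recursively: for $i<j$, $(v_i,v_j)$ is an arc if and only if $2i - d^-(v_i) \geq j$, where $d^-(v_i)$ is the in-degree of $v_i$ (which depends only on arcs with tails $v_k$, $k<i$); there are no other arcs. For $n \in \mathbb{N}$, the finite Jaco graph $J_n(1)$ is the subgraph of $J_\infty(1)$ induced on $\{v_1,\dots,v_n\}$. $\epsilon(G)$ denotes the number of edges (arcs) of $G$. Here $d^+(v_i)$ denotes the out-degree of $v_i$ in the infinite graph $J_\infty(1)$, which equals $i - d^-(v_i)$. -}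

module Defs where

open import Data.Nat using (ℕ; zero; suc; _+_; _*_; _∸_; _≤ᵇ_)
open import Data.Bool using (Bool; true; false; if_then_else_; _∧_)
open import Data.List using (List; []; _∷_; _++_)

countRange : (ℕ → Bool) → ℕ → ℕ → ℕ
countRange p lo zero = 0
countRange p lo (suc len) = (if p lo then 1 else 0) + countRange p (suc lo) len

-- given ds = [d⁻(v_i), d⁻(v_{i+1}), ...] starting at index i, count the
-- tails v_k (k ≥ i, within the list) with 2k - d⁻(v_k) ≥ j
countTails : List ℕ → ℕ → ℕ → ℕ
countTails [] i j = 0
countTails (d ∷ ds) i j = (if j ≤ᵇ (2 * i ∸ d) then 1 else 0) + countTails ds (suc i) j

-- inDegs n = [d⁻(v_1), …, d⁻(v_n)]  (computed recursively, as in the definition)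
inDegs : ℕ → List ℕ
-- d⁻(v_{n+1}) = #{ k ∈ {1..n} : 2k - d⁻(v_k) ≥ n+1 }
newDeg : ℕ → ℕ
inDegs zero = []
inDegs (suc n) = inDegs n ++ (newDeg n ∷ [])
newDeg n = countTails (inDegs n) 1 (suc n)

-- in-degree of v_i in J_∞(1)  (indices start at 1; index 0 is unused)
indeg : ℕ → ℕ
indeg zero = 0
indeg (suc n) = newDeg n

arc : ℕ → ℕ → Bool
arc i j = (1 ≤ᵇ i) ∧ (suc i ≤ᵇ j) ∧ (j ≤ᵇ (2 * i ∸ indeg i))

-- out-degree of v_i in J_∞(1): heads v_j with arc (v_i,v_j); necessarily j ∈ (i, 2i]
outdeg : ℕ → ℕ
outdeg i = countRange (arc i) (suc i) i

sumRange : (ℕ → ℕ) → ℕ → ℕ → ℕ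
sumRange f lo zero = 0
sumRange f lo (suc len) = f lo + sumRange f (suc lo) len

edges : ℕ → ℕ
edges n = sumRange (λ i → countRange (arc i) 1 n) 1 n

-- The whole argument runs through the "reach" of a vertex,
-- reach k = 2k - d⁻(v_k): the arcs out of v_k go exactly to v_{k+1} … v_{reach k}.
-- For N ≥ 1 the *pivot* of N is the least K with N ≤ reach K.
--
--  * d⁻(v_{m+1}) counts the k ≤ m with reach k ≥ m + 1.  If reach is increasing
--    on [0, m], these are exactly the k in [pivot(m+1), m], so
--    d⁻(v_{m+1}) + pivot(m+1) = m + 1, i.e. reach (m+1) = (m+1) + pivot(m+1).
--  * Since pivots are monotone in N, this shows by induction that reach is
--    strictly increasing everywhere, and that it grows by at most 2 per step.
--  * Consequently d⁺(v_N) = reach N - N = pivot(N), and the pivot K of p overshoots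
--    p by at most one: reach K ≤ p + 1.
--  * Adding v_{p+1} to J_p(1) adds exactly its d⁻(v_{p+1}) incoming arcs.
--
-- For the proposition put p = n - 1 and K = pivot(p) = d⁺(v_p).  Then
-- K + d⁺(v_K) = reach K, so the hypothesis says reach K ≠ p; hence reach K = p + 1,
-- K is also the pivot of p + 1, and d⁻(v_{p+1}) = p + 1 - K = d⁺(v_K).
module Submission where

open import Defs
open import Data.Nat using (ℕ; _+_; _∸_; _≤_)
open import Data.Product using (_×_)
open import Relation.Binary.PropositionalEquality using (_≡_; _≢_)

open import Data.Nat using (zero; suc; _*_; _<_; _≤ᵇ_; z≤n; s≤s; z<s)
open import Data.Nat.Properties
open import Data.Bool using (Bool; true; false; if_then_else_; T)
open import Data.List using ([]; _∷_; _++_; length)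
open import Data.List.Properties using (length-++)
open import Data.Product using (Σ; _,_)
open import Data.Sum using (_⊎_; inj₁; inj₂)
open import Data.Empty using (⊥-elim)
open import Data.Unit using (tt)
open import Relation.Nullary using (¬_; yes; no)
open import Relation.Unary using (Decidable)
open import Relation.Binary.PropositionalEquality
  using (refl; sym; trans; cong; cong₂; subst; module ≡-Reasoning)
open import Algebra.Properties.CommutativeSemigroup +-commutativeSemigroup using (interchange)

≤ᵇ-true : ∀ {m n} → m ≤ n → (m ≤ᵇ n) ≡ true
≤ᵇ-true {m} {n} m≤n with m ≤ᵇ n | ≤⇒≤ᵇ m≤n
... | true | _ = refl

≤ᵇ-false : ∀ {m n} → n < m → (m ≤ᵇ n) ≡ false
≤ᵇ-false {m} {n} n<m with m ≤ᵇ n in eq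
... | false = refl
... | true  = ⊥-elim (<⇒≱ n<m (≤ᵇ⇒≤ m n (subst T (sym eq) tt)))

On : ℕ → ℕ → (ℕ → Set) → Set
On lo len Q = ∀ k → lo ≤ k → k < lo + len → Q k

On-head : ∀ {lo len Q} → On lo (suc len) Q → Q lo
On-head {lo} h = h lo ≤-refl (m<m+n lo z<s)

On-tail : ∀ {lo len Q} → On lo (suc len) Q → On (suc lo) len Q
On-tail {lo} {len} h k lo<k k<end =
  h k (≤-trans (n≤1+n lo) lo<k) (≤-trans k<end (≤-reflexive (sym (+-suc lo len))))

countRange-cong : ∀ p q lo len → On lo len (λ k → p k ≡ q k) →
  countRange p lo len ≡ countRange q lo len
countRange-cong p q lo zero      h = refl
countRange-cong p q lo (suc len) h =
  cong₂ (λ b c → (if b then 1 else 0) + c) (On-head h)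
        (countRange-cong p q (suc lo) len (On-tail h))

countRange-false : ∀ p lo len → On lo len (λ k → p k ≡ false) → countRange p lo len ≡ 0
countRange-false p lo zero      h = refl
countRange-false p lo (suc len) h
  rewrite On-head h = countRange-false p (suc lo) len (On-tail h)

countRange-true : ∀ p lo len → On lo len (λ k → p k ≡ true) → countRange p lo len ≡ len
countRange-true p lo zero      h = refl
countRange-true p lo (suc len) h
  rewrite On-head h = cong suc (countRange-true p (suc lo) len (On-tail h))

countRange-≤ : ∀ p lo len → countRange p lo len ≤ len
countRange-≤ p lo zero = z≤n
countRange-≤ p lo (suc len) with p lo
... | true  = s≤s (countRange-≤ p (suc lo) len)
... | false = ≤-trans (countRange-≤ p (suc lo) len) (n≤1+n len)

countRange-split : ∀ p lo a b →
  countRange p lo (a + b) ≡ countRange p lo a + countRange p (lo + a) b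
countRange-split p lo zero    b = cong (λ l → countRange p l b) (sym (+-identityʳ lo))
countRange-split p lo (suc a) b = begin
    (if p lo then 1 else 0) + countRange p (suc lo) (a + b)
  ≡⟨ cong (_ +_) (countRange-split p (suc lo) a b) ⟩
    (if p lo then 1 else 0) + (countRange p (suc lo) a + countRange p (suc lo + a) b)
  ≡⟨ sym (+-assoc (if p lo then 1 else 0) (countRange p (suc lo) a) _) ⟩
    countRange p lo (suc a) + countRange p (suc (lo + a)) b
  ≡⟨ cong (λ l → countRange p lo (suc a) + countRange p l b) (sym (+-suc lo a)) ⟩
    countRange p lo (suc a) + countRange p (lo + suc a) b ∎
  where open ≡-Reasoning

countRange-snoc : ∀ p lo len →
  countRange p lo (suc len) ≡ countRange p lo len + (if p (lo + len) then 1 else 0)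
countRange-snoc p lo len = begin
    countRange p lo (suc len)
  ≡⟨ cong (countRange p lo) (+-comm 1 len) ⟩
    countRange p lo (len + 1)
  ≡⟨ countRange-split p lo len 1 ⟩
    countRange p lo len + ((if p (lo + len) then 1 else 0) + 0)
  ≡⟨ cong (countRange p lo len +_) (+-identityʳ _) ⟩
    countRange p lo len + (if p (lo + len) then 1 else 0) ∎
  where open ≡-Reasoning

countRange-prefix : ∀ p lo a b →
  On lo a (λ k → p k ≡ true) → On (lo + a) b (λ k → p k ≡ false) →
  countRange p lo (a + b) ≡ a
countRange-prefix p lo a b ht hf = begin
    countRange p lo (a + b)
  ≡⟨ countRange-split p lo a b ⟩
    countRange p lo a + countRange p (lo + a) b
  ≡⟨ cong₂ _+_ (countRange-true p lo a ht) (countRange-false p (lo + a) b hf) ⟩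
    a + 0
  ≡⟨ +-identityʳ a ⟩
    a ∎
  where open ≡-Reasoning

countRange-suffix : ∀ p lo a b →
  On lo a (λ k → p k ≡ false) → On (lo + a) b (λ k → p k ≡ true) →
  countRange p lo (a + b) ≡ b
countRange-suffix p lo a b hf ht = begin
    countRange p lo (a + b)
  ≡⟨ countRange-split p lo a b ⟩
    countRange p lo a + countRange p (lo + a) b
  ≡⟨ cong₂ _+_ (countRange-false p lo a hf) (countRange-true p (lo + a) b ht) ⟩
    b ∎
  where open ≡-Reasoning

sumRange-snoc : ∀ f lo len → sumRange f lo (suc len) ≡ sumRange f lo len + f (lo + len)
sumRange-snoc f lo zero = trans (+-comm (f lo) 0) (cong f (sym (+-identityʳ lo)))
sumRange-snoc f lo (suc len) = begin
    f lo + sumRange f (suc lo) (suc len)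
  ≡⟨ cong (f lo +_) (sumRange-snoc f (suc lo) len) ⟩
    f lo + (sumRange f (suc lo) len + f (suc lo + len))
  ≡⟨ sym (+-assoc (f lo) _ _) ⟩
    sumRange f lo (suc len) + f (suc (lo + len))
  ≡⟨ cong (λ k → sumRange f lo (suc len) + f k) (sym (+-suc lo len)) ⟩
    sumRange f lo (suc len) + f (lo + suc len) ∎
  where open ≡-Reasoning

sumRange-cong : ∀ f g lo len → On lo len (λ k → f k ≡ g k) →
  sumRange f lo len ≡ sumRange g lo len
sumRange-cong f g lo zero      h = refl
sumRange-cong f g lo (suc len) h =
  cong₂ _+_ (On-head h) (sumRange-cong f g (suc lo) len (On-tail h))

sumRange-+-indicator : ∀ f p lo len →
  sumRange (λ k → f k + (if p k then 1 else 0)) lo len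
    ≡ sumRange f lo len + countRange p lo len
sumRange-+-indicator f p lo zero = refl
sumRange-+-indicator f p lo (suc len) =
  trans (cong (f lo + (if p lo then 1 else 0) +_) (sumRange-+-indicator f p (suc lo) len))
        (interchange (f lo) (if p lo then 1 else 0) (sumRange f (suc lo) len) (countRange p (suc lo) len))

countTails-++ : ∀ xs ys i j →
  countTails (xs ++ ys) i j ≡ countTails xs i j + countTails ys (i + length xs) j
countTails-++ []       ys i j = cong (λ l → countTails ys l j) (sym (+-identityʳ i))
countTails-++ (x ∷ xs) ys i j = begin
    b + countTails (xs ++ ys) (suc i) j
  ≡⟨ cong (b +_) (countTails-++ xs ys (suc i) j) ⟩
    b + (countTails xs (suc i) j + countTails ys (suc i + length xs) j)
  ≡⟨ sym (+-assoc b _ _) ⟩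
    countTails (x ∷ xs) i j + countTails ys (suc (i + length xs)) j
  ≡⟨ cong (λ l → countTails (x ∷ xs) i j + countTails ys l j) (sym (+-suc i (length xs))) ⟩
    countTails (x ∷ xs) i j + countTails ys (i + suc (length xs)) j ∎
  where
  open ≡-Reasoning
  b : ℕ
  b = if j ≤ᵇ (2 * i ∸ x) then 1 else 0

length-inDegs : ∀ n → length (inDegs n) ≡ n
length-inDegs zero    = refl
length-inDegs (suc n) =
  trans (length-++ (inDegs n)) (trans (cong (_+ 1) (length-inDegs n)) (+-comm n 1))

-- The reach of v_k: its out-arcs go to v_{k+1}, …, v_{reach k}.
reach : ℕ → ℕ
reach k = 2 * k ∸ indeg k

Reaches : ℕ → ℕ → Bool
Reaches j k = j ≤ᵇ reach k

countTails-inDegs : ∀ n j → countTails (inDegs n) 1 j ≡ countRange (Reaches j) 1 n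
countTails-inDegs zero    j = refl
countTails-inDegs (suc n) j = begin
    countTails (inDegs n ++ newDeg n ∷ []) 1 j
  ≡⟨ countTails-++ (inDegs n) (newDeg n ∷ []) 1 j ⟩
    countTails (inDegs n) 1 j + countTails (newDeg n ∷ []) (suc (length (inDegs n))) j
  ≡⟨ cong₂ (λ c l → c + countTails (newDeg n ∷ []) (suc l) j)
           (countTails-inDegs n j) (length-inDegs n) ⟩
    countRange (Reaches j) 1 n + ((if Reaches j (suc n) then 1 else 0) + 0)
  ≡⟨ cong (countRange (Reaches j) 1 n +_) (+-identityʳ _) ⟩
    countRange (Reaches j) 1 n + (if Reaches j (1 + n) then 1 else 0)
  ≡⟨ sym (countRange-snoc (Reaches j) 1 n) ⟩
    countRange (Reaches j) 1 (suc n) ∎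
  where open ≡-Reasoning

indeg-count : ∀ n → indeg (suc n) ≡ countRange (Reaches (suc n)) 1 n
indeg-count n = countTails-inDegs n (suc n)

indeg-≤ : ∀ k → indeg k ≤ k
indeg-≤ zero    = z≤n
indeg-≤ (suc n) = ≤-trans (≤-reflexive (indeg-count n))
                          (≤-trans (countRange-≤ (Reaches (suc n)) 1 n) (n≤1+n n))

reach-lower : ∀ k → k ≤ reach k
reach-lower k = begin
    k                   ≡⟨ sym (m+n∸m≡n (indeg k) k) ⟩
    indeg k + k ∸ indeg k ≤⟨ ∸-monoˡ-≤ (indeg k) (+-monoˡ-≤ k (indeg-≤ k)) ⟩
    k + k ∸ indeg k     ≡⟨ cong (λ x → k + x ∸ indeg k) (sym (+-identityʳ k)) ⟩
    reach k             ∎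
  where open ≤-Reasoning

reach-upper : ∀ k → reach k ≤ k + k
reach-upper k = ≤-trans (m∸n≤m (2 * k) (indeg k)) (≤-reflexive (cong (k +_) (+-identityʳ k)))

reach-from-indeg : ∀ s K → indeg s + K ≡ s → reach s ≡ s + K
reach-from-indeg s K e = begin
    s + (s + 0) ∸ indeg s       ≡⟨ cong (λ x → s + x ∸ indeg s) (+-identityʳ s) ⟩
    s + s ∸ indeg s             ≡⟨ cong (λ x → x + s ∸ indeg s) (sym e) ⟩
    indeg s + K + s ∸ indeg s   ≡⟨ cong (_∸ indeg s) (+-assoc (indeg s) K s) ⟩
    indeg s + (K + s) ∸ indeg s ≡⟨ m+n∸m≡n (indeg s) (K + s) ⟩
    K + s                       ≡⟨ +-comm K s ⟩
    s + K                       ∎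
  where open ≡-Reasoning

module _ {P : ℕ → Set} (P? : Decidable P) where

  Least : ℕ → Set
  Least K = (∀ k → k < K → ¬ P k) × P K

  private
    least-below : ∀ n → Σ ℕ Least ⊎ (∀ k → k < n → ¬ P k)
    least-below zero = inj₂ (λ k ())
    least-below (suc n) with least-below n
    ... | inj₁ w = inj₁ w
    ... | inj₂ none with P? n
    ...   | yes pn = inj₁ (n , none , pn)
    ...   | no ¬pn = inj₂ extend
      where
      extend : ∀ k → k < suc n → ¬ P k
      extend k k<1+n with m≤n⇒m<n∨m≡n (≤-pred k<1+n)
      ... | inj₁ k<n  = none k k<n
      ... | inj₂ refl = ¬pn

  least-witness : ∀ n → P n → Σ ℕ Least
  least-witness n pn with least-below (suc n)
  ... | inj₁ w    = w
  ... | inj₂ none = ⊥-elim (none n ≤-refl pn)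

Pivot : ℕ → ℕ → Set
Pivot N K = (∀ k → k < K → reach k < N) × N ≤ reach K

pivot-exists : ∀ N → Σ ℕ (Pivot N)
pivot-exists N with least-witness (λ k → N ≤? reach k) N (reach-lower N)
... | K , below , at = K , (λ k k<K → ≰⇒> (below k k<K)) , at

-- A pivot lies below every vertex reaching N; in particular pivots grow with N.
pivot-bound : ∀ {N K n} → Pivot N K → N ≤ reach n → K ≤ n
pivot-bound {N} {K} {n} (below , _) N≤reach with K ≤? n
... | yes K≤n = K≤n
... | no  K≰n = ⊥-elim (<⇒≱ (below n (≰⇒> K≰n)) N≤reach)

pivot-positive : ∀ {N K} → Pivot (suc N) K → 1 ≤ K
pivot-positive {K = suc _} _ = s≤s z≤n

Increasing : ℕ → Set
Increasing n = ∀ k → k < n → reach k < reach (suc k)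

increasing-restrict : ∀ {n} → Increasing (suc n) → Increasing n
increasing-restrict inc k k<n = inc k (m<n⇒m<1+n k<n)

increasing-mono : ∀ {n} → Increasing n → ∀ {k k'} → k ≤ k' → k' ≤ n → reach k ≤ reach k'
increasing-mono inc {k} {zero}    z≤n _ = ≤-refl
increasing-mono inc {k} {suc k'} k≤k' k'<n with m≤n⇒m<n∨m≡n k≤k'
... | inj₂ refl = ≤-refl
... | inj₁ k<1+k' = ≤-trans (increasing-mono inc (≤-pred k<1+k') (≤-trans (n≤1+n k') k'<n))
                            (<⇒≤ (inc k' k'<n))

-- The key count: if reach is increasing on [0, m], the vertices among v_1 … v_m
-- reaching v_{m+1} are those from the pivot K on, so d⁻(v_{m+1}) = m + 1 - K.
indeg-pivot : ∀ {m K} → Increasing m → Pivot (suc m) K → indeg (suc m) + K ≡ suc m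
indeg-pivot {m} {K} inc piv@(below , at) with pivot-positive piv
... | s≤s {n = J} _ = begin
    indeg (suc m) + suc J
  ≡⟨ cong (_+ suc J) (indeg-count m) ⟩
    countRange (Reaches (suc m)) 1 m + suc J
  ≡⟨ cong (λ l → countRange (Reaches (suc m)) 1 l + suc J) (sym (m+[n∸m]≡n J≤m)) ⟩
    countRange (Reaches (suc m)) 1 (J + (m ∸ J)) + suc J
  ≡⟨ cong (_+ suc J) (countRange-suffix (Reaches (suc m)) 1 J (m ∸ J) before after) ⟩
    (m ∸ J) + suc J
  ≡⟨ +-suc (m ∸ J) J ⟩
    suc (m ∸ J + J)
  ≡⟨ cong suc (m∸n+n≡m J≤m) ⟩
    suc m ∎
  where
  open ≡-Reasoning
  J≤m : J ≤ m
  J≤m = ≤-pred (pivot-bound piv (reach-lower (suc m)))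
  before : On 1 J (λ k → Reaches (suc m) k ≡ false)
  before k _ k<K = ≤ᵇ-false (below k k<K)
  after : On (suc J) (m ∸ J) (λ k → Reaches (suc m) k ≡ true)
  after k K≤k k<end = ≤ᵇ-true (≤-trans at (increasing-mono inc K≤k k≤m))
    where
    k≤m : k ≤ m
    k≤m = ≤-pred (≤-trans k<end (≤-reflexive (cong suc (m+[n∸m]≡n J≤m))))

reach-pivot : ∀ {m K} → Increasing m → Pivot (suc m) K → reach (suc m) ≡ suc m + K
reach-pivot {m} {K} inc piv = reach-from-indeg (suc m) K (indeg-pivot inc piv)

-- reach is strictly increasing: reach (m+1) = (m+1) + pivot(m+1), and pivots grow.
reach-increases : ∀ n → Increasing n → reach n < reach (suc n)
reach-increases zero    _   = s≤s z≤n
reach-increases (suc m) inc with pivot-exists (suc m)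
                               | pivot-exists (suc (suc m))
... | K' , piv' | K , piv@(_ , at) = begin-strict
    reach (suc m)       ≡⟨ reach-pivot (increasing-restrict inc) piv' ⟩
    suc m + K'          <⟨ +-mono-<-≤ (n<1+n (suc m)) K'≤K ⟩
    suc (suc m) + K     ≡⟨ sym (reach-pivot inc piv) ⟩
    reach (suc (suc m)) ∎
  where
  open ≤-Reasoning
  K'≤K : K' ≤ K
  K'≤K = pivot-bound piv' (≤-trans (n≤1+n (suc m)) at)

increasing : ∀ n → Increasing n
increasing zero    k ()
increasing (suc n) k k<1+n with m≤n⇒m<n∨m≡n (≤-pred k<1+n)
... | inj₁ k<n  = increasing n k k<n
... | inj₂ refl = reach-increases n (increasing n)

indeg-formula : ∀ {m K} → Pivot (suc m) K → indeg (suc m) + K ≡ suc m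
indeg-formula {m} = indeg-pivot (increasing m)

reach-formula : ∀ {m K} → Pivot (suc m) K → reach (suc m) ≡ suc m + K
reach-formula {m} = reach-pivot (increasing m)

-- reach grows by at most 2 per step: pivot(m+2) ≤ pivot(m+1) + 1.
reach-step : ∀ k → reach (suc k) ≤ 2 + reach k
reach-step zero = ≤-refl
reach-step (suc m) with pivot-exists (suc m)
                      | pivot-exists (suc (suc m))
... | K' , piv'@(_ , at') | K , piv = begin
    reach (suc (suc m))   ≡⟨ reach-formula piv ⟩
    suc (suc m) + K       ≤⟨ +-monoʳ-≤ (suc (suc m)) K≤1+K' ⟩
    suc (suc m) + suc K'  ≡⟨ cong suc (+-suc (suc m) K') ⟩
    2 + (suc m + K')      ≡⟨ cong (2 +_) (sym (reach-formula piv')) ⟩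
    2 + reach (suc m)     ∎
  where
  open ≤-Reasoning
  K≤1+K' : K ≤ suc K'
  K≤1+K' = pivot-bound piv (<-≤-trans (s≤s at') (increasing (suc K') K' ≤-refl))

pivot-overshoot : ∀ {N K} → Pivot (suc N) K → reach K ≤ suc (suc N)
pivot-overshoot {N} piv@(below , _) with pivot-positive piv
... | s≤s {n = J} _ = ≤-trans (reach-step J) (s≤s (below J ≤-refl))

outdeg-reach : ∀ i → outdeg i ≡ reach i ∸ i
outdeg-reach zero    = refl
outdeg-reach i@(suc _) = begin
    countRange (arc i) (suc i) i
  ≡⟨ countRange-cong (arc i) Reached (suc i) i arc≡ ⟩
    countRange Reached (suc i) i
  ≡⟨ cong (countRange Reached (suc i)) (sym (m+[n∸m]≡n a≤i)) ⟩
    countRange Reached (suc i) (a + (i ∸ a))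
  ≡⟨ countRange-prefix Reached (suc i) a (i ∸ a) near far ⟩
    a ∎
  where
  open ≡-Reasoning
  Reached : ℕ → Bool
  Reached j = j ≤ᵇ reach i
  a : ℕ
  a = reach i ∸ i
  a≤i : a ≤ i
  a≤i = m≤n+o⇒m∸n≤o (reach i) i (reach-upper i)
  end≡ : suc i + a ≡ suc (reach i)
  end≡ = cong suc (m+[n∸m]≡n (reach-lower i))
  arc≡ : On (suc i) i (λ j → arc i j ≡ Reached j)
  arc≡ j i<j _ rewrite ≤ᵇ-true i<j = refl
  near : On (suc i) a (λ j → Reached j ≡ true)
  near j _ j<end = ≤ᵇ-true (≤-pred (subst (j <_) end≡ j<end))
  far : On (suc i + a) (i ∸ a) (λ j → Reached j ≡ false)
  far j end≤j _ = ≤ᵇ-false (subst (_≤ j) end≡ end≤j)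

outdeg-pivot : ∀ {m K} → Pivot (suc m) K → outdeg (suc m) ≡ K
outdeg-pivot {m} {K} piv = begin
    outdeg (suc m)         ≡⟨ outdeg-reach (suc m) ⟩
    reach (suc m) ∸ suc m  ≡⟨ cong (_∸ suc m) (reach-formula piv) ⟩
    suc m + K ∸ suc m      ≡⟨ m+n∸m≡n (suc m) K ⟩
    K                      ∎
  where open ≡-Reasoning

outdeg-sum : ∀ K → K + outdeg K ≡ reach K
outdeg-sum K = trans (cong (K +_) (outdeg-reach K)) (m+[n∸m]≡n (reach-lower K))

no-backward-arcs : ∀ i → countRange (arc i) 1 i ≡ 0
no-backward-arcs i = countRange-false (arc i) 1 i backward
  where
  backward : On 1 i (λ j → arc i j ≡ false)
  backward j _ j<i with 1 ≤ᵇ i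
  ... | false = refl
  ... | true  rewrite ≤ᵇ-false j<i = refl

arcs-into : ∀ p → countRange (λ i → arc i (suc p)) 1 p ≡ indeg (suc p)
arcs-into p = trans (countRange-cong (λ i → arc i (suc p)) (Reaches (suc p)) 1 p arc≡)
                    (sym (indeg-count p))
  where
  arc≡ : On 1 p (λ i → arc i (suc p) ≡ Reaches (suc p) i)
  arc≡ i 1≤i i<1+p rewrite ≤ᵇ-true 1≤i | ≤ᵇ-true i<1+p = refl

edges-suc : ∀ p → edges (suc p) ≡ edges p + indeg (suc p)
edges-suc p = begin
    sumRange Out' 1 (suc p)
  ≡⟨ sumRange-snoc Out' 1 p ⟩
    sumRange Out' 1 p + Out' (suc p)
  ≡⟨ cong₂ _+_ (sumRange-cong Out' _ 1 p (λ i _ _ → countRange-snoc (arc i) 1 p))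
               (no-backward-arcs (suc p)) ⟩
    sumRange (λ i → Out i + (if arc i (suc p) then 1 else 0)) 1 p + 0
  ≡⟨ +-identityʳ _ ⟩
    sumRange (λ i → Out i + (if arc i (suc p) then 1 else 0)) 1 p
  ≡⟨ sumRange-+-indicator Out (λ i → arc i (suc p)) 1 p ⟩
    edges p + countRange (λ i → arc i (suc p)) 1 p
  ≡⟨ cong (edges p +_) (arcs-into p) ⟩
    edges p + indeg (suc p) ∎
  where
  open ≡-Reasoning
  Out Out' : ℕ → ℕ
  Out  i = countRange (arc i) 1 p
  Out' i = countRange (arc i) 1 (suc p)

pivot-successor : ∀ q K → let p = suc q in Pivot p K → K + outdeg K ≢ p →
  (K ≡ outdeg (suc p)) × (suc p ≡ K + outdeg K) × (edges p + outdeg K ≡ edges (suc p))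
pivot-successor q K piv@(below , at) hyp =
  sym (outdeg-pivot piv') , sym (trans (outdeg-sum K) reach-K) , edges≡
  where
  p : ℕ
  p = suc q
  beyond : suc p ≤ reach K
  beyond = ≤∧≢⇒< at (λ p≡reach → hyp (trans (outdeg-sum K) (sym p≡reach)))
  piv' : Pivot (suc p) K
  piv' = (λ k k<K → m<n⇒m<1+n (below k k<K)) , beyond
  reach-K : reach K ≡ suc p
  reach-K = ≤-antisym (pivot-overshoot piv) beyond
  indeg≡ : indeg (suc p) ≡ outdeg K
  indeg≡ = begin
      indeg (suc p)         ≡⟨ sym (m+n∸n≡m (indeg (suc p)) K) ⟩
      indeg (suc p) + K ∸ K ≡⟨ cong (_∸ K) (indeg-formula piv') ⟩
      suc p ∸ K             ≡⟨ cong (_∸ K) (sym reach-K) ⟩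
      reach K ∸ K           ≡⟨ sym (outdeg-reach K) ⟩
      outdeg K              ∎
    where open ≡-Reasoning
  edges≡ : edges p + outdeg K ≡ edges (suc p)
  edges≡ = trans (cong (edges p +_) (sym indeg≡)) (sym (edges-suc p))

proposition2p3 : (n : ℕ) → 2 ≤ n →
    outdeg (n ∸ 1) + outdeg (outdeg (n ∸ 1)) ≢ n ∸ 1 →
    (outdeg (n ∸ 1) ≡ outdeg n)
      × (n ≡ outdeg (n ∸ 1) + outdeg (outdeg (n ∸ 1)))
      × (edges (n ∸ 1) + outdeg (outdeg (n ∸ 1)) ≡ edges n)
proposition2p3 (suc zero) (s≤s ()) _
proposition2p3 (suc (suc q)) _ hyp with pivot-exists (suc q)
... | K , piv rewrite outdeg-pivot piv = pivot-successor q K piv hyp
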